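{- Let $\mathcal F\subseteq 2^{[n]}$ contain no induced copy of $2C_2$. Then for any $F,F'\in\mathcal F$, either $\mathcal D_{\mathcal F}(F)\subsetneq\mathcal D_{\mathcal F}(F')$, or $\mathcal D_{\mathcal F}(F')\subsetneq\mathcal D_{\mathcal F}(F)$, or $\mathcal D_{\mathcal F}(F)=\mathcal D_{\mathcal F}(F')$.
   Context: For a family $\mathcal F$ and a set $G$, $\mathcal D_{\mathcal F}(G)=\{F\in\mathcal F: F\subsetneq G\}$. $2C_2$ is the poset on four elements $a<b$, $c<d$ with no other relations. A subfamily $\mathcal G\subseteq\mathcal F$ is an induced copy of a poset $P$ if there is a bijection $i:P\to\mathcal G$ with $p\le_P q$ iff $i(p)\subseteq i(q)$. -}

module Defs where

open import Data.Nat using (ℕ)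
open import Data.Bool using (Bool; true; false)
open import Data.Fin using (Fin; zero; suc)
open import Data.Fin.Subset using (Subset; _⊆_; _⊂_)
open import Data.Product using (Σ; ∃; _×_; _,_)
open import Relation.Binary.PropositionalEquality using (_≡_)
open import Relation.Nullary using (¬_)
open import Function.Definitions using (Injective)

Family : ℕ → Set
Family n = Subset n → Bool

_∈ᶠ_ : ∀ {n} → Subset n → Family n → Set
A ∈ᶠ 𝓕 = 𝓕 A ≡ true

Fam : ℕ → Set₁
Fam n = Subset n → Set

𝓓 : ∀ {n} → Family n → Subset n → Fam n
𝓓 𝓕 G A = (A ∈ᶠ 𝓕) × (A ⊂ G)

_⊆ᶠ_ : ∀ {n} → Fam n → Fam n → Set
P ⊆ᶠ Q = ∀ A → P A → Q A

_≐ᶠ_ : ∀ {n} → Fam n → Fam n → Set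
P ≐ᶠ Q = (P ⊆ᶠ Q) × (Q ⊆ᶠ P)

_⊊ᶠ_ : ∀ {n} → Fam n → Fam n → Set
P ⊊ᶠ Q = (P ⊆ᶠ Q) × ∃ λ A → Q A × ¬ P A

-- The poset 2C₂ on Fin 4: a = 0, b = 1, c = 2, d = 3 with a < b, c < d.
_≤2C2_ : Fin 4 → Fin 4 → Bool
zero ≤2C2 zero = true
zero ≤2C2 suc zero = true
suc zero ≤2C2 suc zero = true
suc (suc zero) ≤2C2 suc (suc zero) = true
suc (suc zero) ≤2C2 suc (suc (suc zero)) = true
suc (suc (suc zero)) ≤2C2 suc (suc (suc zero)) = true
_ ≤2C2 _ = false

InducedCopy2C2 : ∀ {n} → Family n → Set
InducedCopy2C2 {n} 𝓕 =
  Σ (Fin 4 → Subset n) λ i →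
    Injective _≡_ _≡_ i
    × (∀ p → i p ∈ᶠ 𝓕)
    × (∀ p q → ((p ≤2C2 q) ≡ true → i p ⊆ i q) × (i p ⊆ i q → (p ≤2C2 q) ≡ true))

-- If A ∈ 𝓓(F) ∖ 𝓓(F′) and B ∈ 𝓓(F′) ∖ 𝓓(F), then A ⊊ F and B ⊊ F′ while A ⊊ F′
-- and B ⊊ F both fail; the two chains A ⊊ F and B ⊊ F′ are then mutually
-- incomparable, i.e. an induced 2C₂. Hence one of 𝓓(F), 𝓓(F′) contains the
-- other, and since membership in 𝓓 is decidable this gives the trichotomy.
module Submission where

open import Defs
open import Data.Nat using (ℕ)
open import Data.Bool using (true; false)
open import Data.Bool.Properties using () renaming (_≟_ to _≟ᵇ_)
open import Data.Fin using (Fin; zero; suc; _≟_)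
open import Data.Fin.Properties using (all?)
open import Data.Fin.Subset using (Subset; _⊆_; _⊂_)
open import Data.Fin.Subset.Properties
  using (_∈?_; _⊂?_; ⊆-refl; ⊂-trans; ⊂-⊆-trans; ⊆-⊂-trans; ⊂-irref; anySubset?)
open import Data.Product using (∃; _×_; _,_; proj₁; proj₂)
open import Data.Empty using (⊥-elim)
open import Data.Sum using (_⊎_; inj₁; inj₂)
open import Relation.Nullary using (¬_; yes; no; contradiction)
open import Relation.Nullary.Decidable using (_×-dec_; _→-dec_; ¬?; from-yes)
open import Relation.Binary.PropositionalEquality using (_≡_; refl; subst)
open import Relation.Unary using (Decidable)

module _ {n : ℕ} where

  _⊈ᶠ_ : Fam n → Fam n → Set
  P ⊈ᶠ Q = ∃ λ A → P A × ¬ Q A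

  ⊆ᶠ⊎⊈ᶠ : {P Q : Fam n} → Decidable P → Decidable Q → (P ⊆ᶠ Q) ⊎ (P ⊈ᶠ Q)
  ⊆ᶠ⊎⊈ᶠ {P} {Q} P? Q? with anySubset? (λ A → P? A ×-dec ¬? (Q? A))
  ... | yes P⊈Q = inj₂ P⊈Q
  ... | no ¬P⊈Q = inj₁ P⊆Q
    where
    P⊆Q : P ⊆ᶠ Q
    P⊆Q A PA with Q? A
    ... | yes QA = QA
    ... | no ¬QA = contradiction (A , PA , ¬QA) ¬P⊈Q

  ⊊ᶠ-trichotomy : {P Q : Fam n} → Decidable P → Decidable Q →
                  ¬ ((P ⊈ᶠ Q) × (Q ⊈ᶠ P)) → (P ⊊ᶠ Q) ⊎ (Q ⊊ᶠ P) ⊎ (P ≐ᶠ Q)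
  ⊊ᶠ-trichotomy P? Q? ¬crossing with ⊆ᶠ⊎⊈ᶠ P? Q? | ⊆ᶠ⊎⊈ᶠ Q? P?
  ... | inj₁ P⊆Q | inj₁ Q⊆P = inj₂ (inj₂ (P⊆Q , Q⊆P))
  ... | inj₁ P⊆Q | inj₂ Q⊈P = inj₁ (P⊆Q , Q⊈P)
  ... | inj₂ P⊈Q | inj₁ Q⊆P = inj₂ (inj₁ (Q⊆P , P⊈Q))
  ... | inj₂ P⊈Q | inj₂ Q⊈P = contradiction (P⊈Q , Q⊈P) ¬crossing

  𝓓? : (𝓕 : Family n) (G : Subset n) → Decidable (𝓓 𝓕 G)
  𝓓? 𝓕 G A = (𝓕 A ≟ᵇ true) ×-dec (A ⊂? G)

  ⊆∧⊄⇒⊇ : {p q : Subset n} → p ⊆ q → ¬ p ⊂ q → q ⊆ p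
  ⊆∧⊄⇒⊇ {p} p⊆q p⊄q {x} x∈q with x ∈? p
  ... | yes x∈p = x∈p
  ... | no x∉p = ⊥-elim (p⊄q (p⊆q , x , x∈q , x∉p))

  module CrossedChains {A F B F′ : Subset n}
    (A⊂F : A ⊂ F) (B⊂F′ : B ⊂ F′) (A⊄F′ : ¬ A ⊂ F′) (B⊄F : ¬ B ⊂ F) where

    A⊈F′ : ¬ A ⊆ F′
    A⊈F′ A⊆F′ = B⊄F (⊂-trans (⊂-⊆-trans B⊂F′ (⊆∧⊄⇒⊇ A⊆F′ A⊄F′)) A⊂F)

    A⊈B : ¬ A ⊆ B
    A⊈B A⊆B = A⊄F′ (⊆-⊂-trans A⊆B B⊂F′)

    F⊈A : ¬ F ⊆ A
    F⊈A F⊆A = ⊂-irref refl (⊂-⊆-trans A⊂F F⊆A)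

    F⊈B : ¬ F ⊆ B
    F⊈B F⊆B = A⊈B (proj₁ (⊂-⊆-trans A⊂F F⊆B))

    F⊈F′ : ¬ F ⊆ F′
    F⊈F′ F⊆F′ = A⊄F′ (⊂-⊆-trans A⊂F F⊆F′)

pattern a = zero
pattern b = suc zero
pattern c = suc (suc zero)
pattern d = suc (suc (suc zero))

≤2C2-antisym : ∀ p q → (p ≤2C2 q) ≡ true → (q ≤2C2 p) ≡ true → p ≡ q
≤2C2-antisym = from-yes (all? λ p → all? λ q →
  (p ≤2C2 q ≟ᵇ true) →-dec (q ≤2C2 p ≟ᵇ true) →-dec (p ≟ q))

module _ {n : ℕ} (𝓕 : Family n) where

  order-embedding⇒InducedCopy2C2 : (i : Fin 4 → Subset n) → (∀ p → i p ∈ᶠ 𝓕) →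
    (∀ p q → ((p ≤2C2 q) ≡ true → i p ⊆ i q) × (i p ⊆ i q → (p ≤2C2 q) ≡ true)) →
    InducedCopy2C2 𝓕
  order-embedding⇒InducedCopy2C2 i i∈𝓕 i-embedding = i , injective , i∈𝓕 , i-embedding
    where
    reflects : ∀ {p q} → i p ⊆ i q → (p ≤2C2 q) ≡ true
    reflects {p} {q} = proj₂ (i-embedding p q)

    injective : ∀ {p q} → i p ≡ i q → p ≡ q
    injective {p} {q} ip≡iq = ≤2C2-antisym p q
      (reflects (subst (i p ⊆_) ip≡iq ⊆-refl))
      (reflects (subst (_⊆ i p) ip≡iq ⊆-refl))

  crossed-chains⇒InducedCopy2C2 : {A F B F′ : Subset n} →
    A ∈ᶠ 𝓕 → F ∈ᶠ 𝓕 → B ∈ᶠ 𝓕 → F′ ∈ᶠ 𝓕 →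
    A ⊂ F → B ⊂ F′ → ¬ A ⊂ F′ → ¬ B ⊂ F → InducedCopy2C2 𝓕
  crossed-chains⇒InducedCopy2C2 {A} {F} {B} {F′} A∈𝓕 F∈𝓕 B∈𝓕 F′∈𝓕 A⊂F B⊂F′ A⊄F′ B⊄F =
    order-embedding⇒InducedCopy2C2 i i∈𝓕 i-embedding
    where
    open CrossedChains A⊂F B⊂F′ A⊄F′ B⊄F
    open CrossedChains B⊂F′ A⊂F B⊄F A⊄F′
      renaming (A⊈F′ to B⊈F; A⊈B to B⊈A; F⊈A to F′⊈B; F⊈B to F′⊈A; F⊈F′ to F′⊈F)

    i : Fin 4 → Subset n
    i a = A
    i b = F
    i c = B
    i d = F′

    i∈𝓕 : ∀ p → i p ∈ᶠ 𝓕
    i∈𝓕 a = A∈𝓕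
    i∈𝓕 b = F∈𝓕
    i∈𝓕 c = B∈𝓕
    i∈𝓕 d = F′∈𝓕

    holds : {P Q : Subset n} → P ⊆ Q → (true ≡ true → P ⊆ Q) × (P ⊆ Q → true ≡ true)
    holds P⊆Q = (λ _ → P⊆Q) , (λ _ → refl)

    fails : {P Q : Subset n} → ¬ P ⊆ Q → (false ≡ true → P ⊆ Q) × (P ⊆ Q → false ≡ true)
    fails P⊈Q = (λ ()) , (λ P⊆Q → ⊥-elim (P⊈Q P⊆Q))

    i-embedding : ∀ p q → ((p ≤2C2 q) ≡ true → i p ⊆ i q) × (i p ⊆ i q → (p ≤2C2 q) ≡ true)
    i-embedding a a = holds ⊆-refl
    i-embedding a b = holds (proj₁ A⊂F)
    i-embedding a c = fails A⊈B
    i-embedding a d = fails A⊈F′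
    i-embedding b a = fails F⊈A
    i-embedding b b = holds ⊆-refl
    i-embedding b c = fails F⊈B
    i-embedding b d = fails F⊈F′
    i-embedding c a = fails B⊈A
    i-embedding c b = fails B⊈F
    i-embedding c c = holds ⊆-refl
    i-embedding c d = holds (proj₁ B⊂F′)
    i-embedding d a = fails F′⊈A
    i-embedding d b = fails F′⊈F
    i-embedding d c = fails F′⊈B
    i-embedding d d = holds ⊆-refl

proposition20 : (n : ℕ) (𝓕 : Family n) → ¬ InducedCopy2C2 𝓕 →
    (F F′ : Subset n) → F ∈ᶠ 𝓕 → F′ ∈ᶠ 𝓕 →
    (𝓓 𝓕 F ⊊ᶠ 𝓓 𝓕 F′) ⊎ (𝓓 𝓕 F′ ⊊ᶠ 𝓓 𝓕 F) ⊎ (𝓓 𝓕 F ≐ᶠ 𝓓 𝓕 F′)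
proposition20 n 𝓕 no-2C2 F F′ F∈𝓕 F′∈𝓕 =
  ⊊ᶠ-trichotomy (𝓓? 𝓕 F) (𝓓? 𝓕 F′) crossing-impossible
  where
  crossing-impossible : ¬ ((𝓓 𝓕 F ⊈ᶠ 𝓓 𝓕 F′) × (𝓓 𝓕 F′ ⊈ᶠ 𝓓 𝓕 F))
  crossing-impossible ((A , (A∈𝓕 , A⊂F) , A∉𝓓F′) , (B , (B∈𝓕 , B⊂F′) , B∉𝓓F)) =
    no-2C2 (crossed-chains⇒InducedCopy2C2 𝓕 A∈𝓕 F∈𝓕 B∈𝓕 F′∈𝓕 A⊂F B⊂F′
      (λ A⊂F′ → A∉𝓓F′ (A∈𝓕 , A⊂F′)) (λ B⊂F → B∉𝓓F (B∈𝓕 , B⊂F)))
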